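{- Let $k,\ell,b,n_1,n_2$ be positive integers with $k,\ell\leq b$, $2(k+b)\leq n_1$, $2(\ell+b)\leq n_2$. Let $\mathcal{R}$ be a proj-intersecting family of $k\times\ell$ rectangles in $\mathbb{Z}_{n_1}\times\mathbb{Z}_{n_2}$ with $|\mathcal{R}|\geq 9b^2$. Then either there are two rectangles $R_1,R_2\in\mathcal{R}$ with $R_1=I_1\times J_0$, $R_2=I_2\times J_0$ and $d(I_1,I_2)\geq b+1$, or there are two rectangles $R_3,R_4\in\mathcal{R}$ with $R_3=I_0\times J_3$, $R_4=I_0\times J_4$ and $d(J_3,J_4)\geq b+1$.
   Context: For $u,v\in\mathbb{Z}_n$ the distance $d(u,v)$ is the smaller of $(u-v)\bmod n$ and $(v-u)\bmod n$. An interval of length $a$ in $\mathbb{Z}_n$ is a set $\{i+1,\ldots,i+a\}$ (mod $n$); the distance of two intervals is the minimum distance between an element of one and an element of the other. A $k\times\ell$ rectangle in $\mathbb{Z}_{n_1}\times\mathbb{Z}_{n_2}$ is a set $I\times J$ where $I$ is an interval of length $k$ in $\mathbb{Z}_{n_1}$ and $J$ is an interval of length $\ell$ in $\mathbb{Z}_{n_2}$. Rectangles $I_1\times J_1$ and $I_2\times J_2$ are proj-intersecting if $I_1\cap I_2\neq\emptyset$ or $J_1\cap J_2\neq\emptyset$; a family of rectangles is proj-intersecting if any two of its members are proj-intersecting. -}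

module Defs where

open import Data.Nat using (ℕ; zero; suc; _+_; _*_; _∸_; _≤_; _<_; _≥_; NonZero)
open import Data.Nat.DivMod using (_%_)
open import Data.Fin using (Fin; toℕ)
open import Data.Product using (Σ; ∃; ∃-syntax; _×_; _,_; proj₁; proj₂)
open import Data.Sum using (_⊎_)
open import Data.List using (List; length)
open import Data.List.Membership.Propositional using (_∈_)
open import Data.List.Relation.Unary.Unique.Propositional using (Unique)
open import Relation.Binary.PropositionalEquality using (_≡_)

diffMod : (n : ℕ) .{{_ : NonZero n}} → Fin n → Fin n → ℕ
diffMod n u v = (toℕ u + n ∸ toℕ v) % n

dist : (n : ℕ) .{{_ : NonZero n}} → Fin n → Fin n → ℕ
dist n u v = Data.Nat._⊓_ (diffMod n u v) (diffMod n v u)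
  where import Data.Nat

-- The interval of length a starting after i: {i+1, …, i+a} (mod n).
-- x belongs to it iff x ≡ i + t (mod n) for some 1 ≤ t ≤ a.
InInterval : (n : ℕ) .{{_ : NonZero n}} → (a : ℕ) → (i : Fin n) → Fin n → Set
InInterval n a i x = ∃[ t ] (1 ≤ t × t ≤ a × toℕ x ≡ (toℕ i + t) % n)

IntervalsMeet : (n : ℕ) .{{_ : NonZero n}} → (a : ℕ) → Fin n → Fin n → Set
IntervalsMeet n a i j = ∃[ x ] (InInterval n a i x × InInterval n a j x)

IntervalDist≥ : (n : ℕ) .{{_ : NonZero n}} → (a : ℕ) → Fin n → Fin n → ℕ → Set
IntervalDist≥ n a i j m =
  ∀ u v → InInterval n a i u → InInterval n a j v → m ≤ dist n u v

-- A k×ℓ rectangle I × J in Z_{n1} × Z_{n2} is represented by the pair of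
-- start points (i , j) with I = {i+1..i+k}, J = {j+1..j+ℓ}.
Rect : ℕ → ℕ → Set
Rect n₁ n₂ = Fin n₁ × Fin n₂

ProjIntersecting : (n₁ n₂ : ℕ) .{{_ : NonZero n₁}} .{{_ : NonZero n₂}} →
                   (k ℓ : ℕ) → List (Rect n₁ n₂) → Set
ProjIntersecting n₁ n₂ k ℓ ℛ =
  ∀ R S → R ∈ ℛ → S ∈ ℛ →
    IntervalsMeet n₁ k (proj₁ R) (proj₁ S) ⊎ IntervalsMeet n₂ ℓ (proj₂ R) (proj₂ S)

module Submission where

-- If no two rectangles on a common row (equal J) have intervals at distance at least b + 1, then any
-- two of them have starting points within k + b - 1; symmetrically for columns. Fix R₀ ∈ ℛ. Every
-- member meets R₀ in a projection, so its I starts within k - 1 of R₀'s or its J starts within ℓ - 1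
-- of R₀'s. Members of the first kind lie in at most 2k - 1 columns, and the J's of one column are
-- pairwise within b + ℓ - 1, so a column holds at most b + ℓ of them (as 2(b + ℓ) ≤ n₂). Hence
-- |ℛ| ≤ (2k - 1)(b + ℓ) + (2ℓ - 1)(b + k) < 9b².

open import Defs
open import Data.Nat using (ℕ; zero; suc; pred; _+_; _*_; _∸_; _≤_; _<_; _≥_; ∣_-_∣; _≤?_; _<?_; _≟_; NonZero; z≤n; s≤s; z<s)
open import Data.Nat.Properties
open import Data.Nat.DivMod
open import Data.Fin using (Fin; toℕ)
open import Data.Fin.Properties using (toℕ<n; toℕ-injective)
import Data.Fin as Fin
open import Data.Product using (∃-syntax; _×_; _,_; proj₁; proj₂)
open import Data.Product.Properties using (×-≡,≡→≡)
open import Data.Sum using (_⊎_; inj₁; inj₂)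
open import Data.List using (List; []; _∷_; length; filter)
open import Data.List.Membership.Propositional using (_∈_; find; lose)
open import Data.List.Membership.Propositional.Properties using (∈-filter⁻)
open import Data.List.Relation.Unary.Any using (Any; here; there; any?)
open import Data.List.Relation.Unary.All using (_∷_)
open import Data.List.Relation.Unary.AllPairs using (_∷_)
open import Data.List.Relation.Unary.Unique.Propositional using (Unique)
open import Data.List.Relation.Unary.Unique.Propositional.Properties using (filter⁺)
open import Data.Nat.Tactic.RingSolver using (solve-∀)
open import Relation.Binary.PropositionalEquality
open import Relation.Nullary using (Dec; ¬_; ¬?; yes; no; contradiction; _×-dec_; decidable-stable)
open import Relation.Unary using (Decidable)
open import Algebra.Properties.CommutativeSemigroup +-commutativeSemigroup using (xy∙z≈xz∙y)

∣-∣-window : ∀ {K t s} → 1 ≤ t → t ≤ suc K → 1 ≤ s → s ≤ suc K → ∣ t - s ∣ ≤ K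
∣-∣-window {t = suc t} {suc s} _ (s≤s t≤K) _ (s≤s s≤K) = ≤-trans (∣m-n∣≤m⊔n t s) (⊔-lub t≤K s≤K)

%-window : ∀ d .{{_ : NonZero d}} x → x < d + d → x < d × x % d ≡ x ⊎ d ≤ x × x % d ≡ x ∸ d
%-window d x x<2d with x <? d
... | yes x<d = inj₁ (x<d , m<n⇒m%n≡m x<d)
... | no x≮d = inj₂ (d≤x , trans (sym (m≤n⇒[n∸m]%m≡n%m d≤x)) (m<n⇒m%n≡m (m<n+o⇒m∸n<o x d x<2d)))
  where
  d≤x : d ≤ x
  d≤x = ≮⇒≥ x≮d

%-window-injective : ∀ d .{{_ : NonZero d}} {x y} → x < d + d → y < d + d → x % d ≡ y % d →
                     x ≡ y ⊎ y ≡ x + d ⊎ x ≡ y + d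
%-window-injective d {x} {y} x<2d y<2d eq with %-window d x x<2d | %-window d y y<2d
... | inj₁ (_ , x%d≡x) | inj₁ (_ , y%d≡y) = inj₁ (trans (sym x%d≡x) (trans eq y%d≡y))
... | inj₁ (_ , x%d≡x) | inj₂ (d≤y , y%d≡y∸d) =
  inj₂ (inj₁ (trans (sym (m∸n+n≡m d≤y)) (cong (_+ d) (trans (sym y%d≡y∸d) (trans (sym eq) x%d≡x)))))
... | inj₂ (d≤x , x%d≡x∸d) | inj₁ (_ , y%d≡y) =
  inj₂ (inj₂ (trans (sym (m∸n+n≡m d≤x)) (cong (_+ d) (trans (sym x%d≡x∸d) (trans eq y%d≡y)))))
... | inj₂ (d≤x , x%d≡x∸d) | inj₂ (d≤y , y%d≡y∸d) =
  inj₁ (∸-cancelʳ-≡ d≤x d≤y (trans (sym x%d≡x∸d) (trans eq y%d≡y∸d)))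

module Cyclic (n : ℕ) .{{_ : NonZero n}} where

  infixl 6 _⊕_
  _⊕_ : Fin n → ℕ → ℕ
  u ⊕ e = (toℕ u + e) % n

  [a%n+b]%n≡[a+b]%n : ∀ a b → (a % n + b) % n ≡ (a + b) % n
  [a%n+b]%n≡[a+b]%n a b = begin
    (a % n + b) % n           ≡⟨ %-distribˡ-+ (a % n) b n ⟩
    (a % n % n + b % n) % n   ≡⟨ cong (λ w → (w + b % n) % n) (m%n%n≡m%n a n) ⟩
    (a % n + b % n) % n       ≡⟨ %-distribˡ-+ a b n ⟨
    (a + b) % n               ∎
    where open ≡-Reasoning

  [a+b%n]%n≡[a+b]%n : ∀ a b → (a + b % n) % n ≡ (a + b) % n
  [a+b%n]%n≡[a+b]%n a b = begin
    (a + b % n) % n ≡⟨ cong (_% n) (+-comm a (b % n)) ⟩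
    (b % n + a) % n ≡⟨ [a%n+b]%n≡[a+b]%n b a ⟩
    (b + a) % n     ≡⟨ cong (_% n) (+-comm b a) ⟩
    (a + b) % n     ∎
    where open ≡-Reasoning

  %-+-cancelʳ : ∀ a c s → (a + s) % n ≡ (c + s) % n → a % n ≡ c % n
  %-+-cancelʳ a c s eq = begin
    a % n                          ≡⟨ complete a ⟨
    ((a + s) + s * pred n) % n     ≡⟨ [a%n+b]%n≡[a+b]%n (a + s) _ ⟨
    ((a + s) % n + s * pred n) % n ≡⟨ cong (λ w → (w + s * pred n) % n) eq ⟩
    ((c + s) % n + s * pred n) % n ≡⟨ [a%n+b]%n≡[a+b]%n (c + s) _ ⟩
    ((c + s) + s * pred n) % n     ≡⟨ complete c ⟩
    c % n                          ∎
    where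
    open ≡-Reasoning
    -- adding s (n - 1) turns the summand s into a multiple of n
    complete : ∀ x → ((x + s) + s * pred n) % n ≡ x % n
    complete x = begin
      ((x + s) + s * pred n) % n ≡⟨ cong (_% n) (+-assoc x s _) ⟩
      (x + (s + s * pred n)) % n ≡⟨ cong (λ w → (x + w) % n) (*-suc s (pred n)) ⟨
      (x + s * suc (pred n)) % n ≡⟨ cong (λ w → (x + s * w) % n) (suc-pred n) ⟩
      (x + s * n) % n            ≡⟨ [m+kn]%n≡m%n x s n ⟩
      x % n                      ∎

  toℕ%n≡toℕ : (u : Fin n) → toℕ u % n ≡ toℕ u
  toℕ%n≡toℕ u = m<n⇒m%n≡m (toℕ<n u)

  ⊕-+ : ∀ {u v} a c → toℕ v ≡ u ⊕ a → v ⊕ c ≡ u ⊕ (a + c)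
  ⊕-+ {u} {v} a c v≡u⊕a = begin
    (toℕ v + c) % n           ≡⟨ cong (λ w → (w + c) % n) v≡u⊕a ⟩
    ((toℕ u + a) % n + c) % n ≡⟨ [a%n+b]%n≡[a+b]%n (toℕ u + a) c ⟩
    (toℕ u + a + c) % n       ≡⟨ cong (_% n) (+-assoc (toℕ u) a c) ⟩
    (toℕ u + (a + c)) % n     ∎
    where open ≡-Reasoning

  ⊕-+-cancelʳ : ∀ {i j} t d → i ⊕ t ≡ j ⊕ (t + d) → toℕ i ≡ j ⊕ d
  ⊕-+-cancelʳ {i} {j} t d eq = begin
    toℕ i             ≡⟨ toℕ%n≡toℕ i ⟨
    toℕ i % n         ≡⟨ %-+-cancelʳ (toℕ i) (toℕ j + d) t (trans eq (cong (_% n) regroup)) ⟩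
    (toℕ j + d) % n   ∎
    where
    open ≡-Reasoning
    regroup : toℕ j + (t + d) ≡ toℕ j + d + t
    regroup = trans (sym (+-assoc (toℕ j) t d)) (xy∙z≈xz∙y (toℕ j) t d)

  ⊕-diffMod : ∀ u v → toℕ u ≡ v ⊕ diffMod n u v
  ⊕-diffMod u v = begin
    toℕ u                                ≡⟨ toℕ%n≡toℕ u ⟨
    toℕ u % n                            ≡⟨ [m+n]%n≡m%n (toℕ u) n ⟨
    (toℕ u + n) % n                      ≡⟨ cong (_% n) (m+[n∸m]≡n v≤u+n) ⟨
    (toℕ v + (toℕ u + n ∸ toℕ v)) % n    ≡⟨ [a+b%n]%n≡[a+b]%n (toℕ v) (toℕ u + n ∸ toℕ v) ⟨
    (toℕ v + diffMod n u v) % n          ∎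
    where
    open ≡-Reasoning
    v≤u+n : toℕ v ≤ toℕ u + n
    v≤u+n = ≤-trans (<⇒≤ (toℕ<n v)) (m≤n+m n (toℕ u))

  diffMod-⊕ : ∀ {u v} e → toℕ v ≡ u ⊕ e → diffMod n v u ≡ e % n
  diffMod-⊕ {u} {v} e v≡u⊕e = begin
    diffMod n v u      ≡⟨ m%n%n≡m%n (toℕ v + n ∸ toℕ u) n ⟨
    diffMod n v u % n  ≡⟨ %-+-cancelʳ (diffMod n v u) e (toℕ u) shifts-agree ⟩
    e % n              ∎
    where
    open ≡-Reasoning
    shifts-agree : (diffMod n v u + toℕ u) % n ≡ (e + toℕ u) % n
    shifts-agree = begin
      (diffMod n v u + toℕ u) % n ≡⟨ cong (_% n) (+-comm (diffMod n v u) (toℕ u)) ⟩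
      u ⊕ diffMod n v u           ≡⟨ ⊕-diffMod v u ⟨
      toℕ v                       ≡⟨ v≡u⊕e ⟩
      u ⊕ e                       ≡⟨ cong (_% n) (+-comm (toℕ u) e) ⟩
      (e + toℕ u) % n             ∎

  ⊕-inverse : ∀ {u v} e → e ≤ n → toℕ v ≡ u ⊕ e → toℕ u ≡ v ⊕ (n ∸ e)
  ⊕-inverse {u} {v} e e≤n v≡u⊕e = begin
    toℕ u             ≡⟨ toℕ%n≡toℕ u ⟨
    toℕ u % n         ≡⟨ [m+n]%n≡m%n (toℕ u) n ⟨
    u ⊕ n             ≡⟨ cong (u ⊕_) (m+[n∸m]≡n e≤n) ⟨
    u ⊕ (e + (n ∸ e)) ≡⟨ ⊕-+ e (n ∸ e) v≡u⊕e ⟨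
    v ⊕ (n ∸ e)       ∎
    where open ≡-Reasoning

  dist-sym : ∀ u v → dist n u v ≡ dist n v u
  dist-sym u v = ⊓-comm (diffMod n u v) (diffMod n v u)

  ⊕⇒dist≤ : ∀ {u v} e → toℕ v ≡ u ⊕ e → dist n u v ≤ e
  ⊕⇒dist≤ {u} {v} e v≡u⊕e = begin
    dist n u v    ≤⟨ m⊓n≤n (diffMod n u v) (diffMod n v u) ⟩
    diffMod n v u ≡⟨ diffMod-⊕ e v≡u⊕e ⟩
    e % n         ≤⟨ m%n≤m e n ⟩
    e             ∎
    where open ≤-Reasoning

  ⊕⇒dist≥ : ∀ {u v} e → suc e + suc e ≤ n → toℕ v ≡ u ⊕ suc e → suc e ≤ dist n u v
  ⊕⇒dist≥ {u} {v} e 2e≤n v≡u⊕e = ⊓-glb backward forward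
    where
    open ≤-Reasoning
    e<n : suc e < n
    e<n = <-≤-trans (m<m+n (suc e) z<s) 2e≤n
    forward : suc e ≤ diffMod n v u
    forward = ≤-reflexive (sym (trans (diffMod-⊕ (suc e) v≡u⊕e) (m<n⇒m%n≡m e<n)))
    backward : suc e ≤ diffMod n u v
    backward = begin
      suc e                 ≡⟨ m+n∸m≡n (suc e) (suc e) ⟨
      suc e + suc e ∸ suc e ≤⟨ ∸-monoˡ-≤ (suc e) 2e≤n ⟩
      n ∸ suc e             ≡⟨ m<n⇒m%n≡m (∸-monoʳ-< z<s (<⇒≤ e<n)) ⟨
      (n ∸ suc e) % n       ≡⟨ diffMod-⊕ (n ∸ suc e) (⊕-inverse (suc e) (<⇒≤ e<n) v≡u⊕e) ⟨
      diffMod n u v         ∎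

  dist≤⇒⊕ : ∀ {u v D} → dist n u v ≤ D → ∃[ e ] (e ≤ D × (toℕ v ≡ u ⊕ e ⊎ toℕ u ≡ v ⊕ e))
  dist≤⇒⊕ {u} {v} d≤D with ≤-total (diffMod n u v) (diffMod n v u)
  ... | inj₁ uv≤vu = diffMod n u v , subst (_≤ _) (m≤n⇒m⊓n≡m uv≤vu) d≤D , inj₂ (⊕-diffMod u v)
  ... | inj₂ vu≤uv = diffMod n v u , subst (_≤ _) (m≥n⇒m⊓n≡n vu≤uv) d≤D , inj₁ (⊕-diffMod v u)

  ⊕≡⊕⇒dist≤ : ∀ {i j} t s → i ⊕ t ≡ j ⊕ s → dist n i j ≤ ∣ t - s ∣
  ⊕≡⊕⇒dist≤ {i} {j} t s eq with ≤-total t s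
  ... | inj₁ t≤s with d , refl ← m≤n⇒∃[o]m+o≡n t≤s = begin
    dist n i j       ≡⟨ dist-sym i j ⟩
    dist n j i       ≤⟨ ⊕⇒dist≤ d (⊕-+-cancelʳ t d eq) ⟩
    d                ≡⟨ ∣m-m+n∣≡n t d ⟨
    ∣ t - t + d ∣    ∎
    where open ≤-Reasoning
  ... | inj₂ s≤t with d , refl ← m≤n⇒∃[o]m+o≡n s≤t = begin
    dist n i j       ≤⟨ ⊕⇒dist≤ d (⊕-+-cancelʳ s d (sym eq)) ⟩
    d                ≡⟨ ∣m-m+n∣≡n s d ⟨
    ∣ s - s + d ∣    ≡⟨ ∣-∣-comm s (s + d) ⟩
    ∣ s + d - s ∣    ∎
    where open ≤-Reasoning

  meet⇒dist≤ : ∀ K {i j} → IntervalsMeet n (suc K) i j → dist n i j ≤ K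
  meet⇒dist≤ K (_ , (t , 1≤t , t≤ , x≡i⊕t) , (s , 1≤s , s≤ , x≡j⊕s)) =
    ≤-trans (⊕≡⊕⇒dist≤ t s (trans (sym x≡i⊕t) x≡j⊕s)) (∣-∣-window 1≤t t≤ 1≤s s≤)

  ⊕-points⇒dist≤ : ∀ K {i j u v} e → InInterval n (suc K) i u → InInterval n (suc K) j v →
                   toℕ v ≡ u ⊕ e → dist n j i ≤ K + e
  ⊕-points⇒dist≤ K {i} {j} e (t , 1≤t , t≤ , u≡i⊕t) (s , 1≤s , s≤ , v≡j⊕s) v≡u⊕e = begin
    dist n j i                ≤⟨ ⊕≡⊕⇒dist≤ s (t + e) j⊕s≡i⊕[t+e] ⟩
    ∣ s - t + e ∣             ≤⟨ ∣-∣-triangle s t (t + e) ⟩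
    ∣ s - t ∣ + ∣ t - t + e ∣ ≤⟨ +-mono-≤ (∣-∣-window 1≤s s≤ 1≤t t≤) (≤-reflexive (∣m-m+n∣≡n t e)) ⟩
    K + e                     ∎
    where
    open ≤-Reasoning
    j⊕s≡i⊕[t+e] : j ⊕ s ≡ i ⊕ (t + e)
    j⊕s≡i⊕[t+e] = trans (sym v≡j⊕s) (trans v≡u⊕e (⊕-+ t e u≡i⊕t))

  close-points⇒close-starts : ∀ K B {i j u v} → InInterval n (suc K) i u → InInterval n (suc K) j v →
                              dist n u v ≤ B → dist n i j ≤ K + B
  close-points⇒close-starts K B {i} {j} u∈ v∈ d≤B with dist≤⇒⊕ d≤B
  ... | e , e≤B , inj₁ v≡u⊕e =
    subst (_≤ K + B) (dist-sym j i) (≤-trans (⊕-points⇒dist≤ K e u∈ v∈ v≡u⊕e) (+-monoʳ-≤ K e≤B))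
  ... | e , e≤B , inj₂ u≡v⊕e = ≤-trans (⊕-points⇒dist≤ K e v∈ u∈ u≡v⊕e) (+-monoʳ-≤ K e≤B)

  far-starts⇒far-intervals : ∀ K B {i j} → ¬ dist n i j ≤ K + B → IntervalDist≥ n (suc K) i j (suc B)
  far-starts⇒far-intervals K B far u v u∈ v∈ with dist n u v ≤? B
  ... | yes close = contradiction (close-points⇒close-starts K B u∈ v∈ close) far
  ... | no ¬close = ≰⇒> ¬close

  -- the position of j in the window a - D, …, a + D, when j lies there
  centredOffset : ℕ → Fin n → Fin n → ℕ
  centredOffset D a j = (diffMod n j a + D) % n

  centredOffset-+ : ∀ D a {j j'} e → centredOffset D a j + e ≡ centredOffset D a j' → toℕ j' ≡ j ⊕ e
  centredOffset-+ D a {j} {j'} e eq = begin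
    toℕ j'                    ≡⟨ ⊕-diffMod j' a ⟩
    a ⊕ d'                    ≡⟨ [a+b%n]%n≡[a+b]%n (toℕ a) d' ⟨
    (toℕ a + d' % n) % n      ≡⟨ cong (λ w → (toℕ a + w) % n) d'≡d+e ⟩
    (toℕ a + (d + e) % n) % n ≡⟨ [a+b%n]%n≡[a+b]%n (toℕ a) (d + e) ⟩
    a ⊕ (d + e)               ≡⟨ ⊕-+ d e (⊕-diffMod j a) ⟨
    j ⊕ e                     ∎
    where
    open ≡-Reasoning
    d = diffMod n j a
    d' = diffMod n j' a
    d'≡d+e : d' % n ≡ (d + e) % n
    d'≡d+e = %-+-cancelʳ d' (d + e) D (begin
      (d' + D) % n             ≡⟨ m%n%n≡m%n (d' + D) n ⟨
      (d' + D) % n % n         ≡⟨ cong (_% n) eq ⟨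
      ((d + D) % n + e) % n    ≡⟨ [a%n+b]%n≡[a+b]%n (d + D) e ⟩
      (d + D + e) % n          ≡⟨ cong (_% n) (xy∙z≈xz∙y d D e) ⟩
      (d + e + D) % n          ∎)

  centredOffset-injective : ∀ D a {j j'} → centredOffset D a j ≡ centredOffset D a j' → j ≡ j'
  centredOffset-injective D a {j} {j'} eq = toℕ-injective (sym (begin
    toℕ j'     ≡⟨ centredOffset-+ D a {j} {j'} 0 (trans (+-identityʳ _) eq) ⟩
    j ⊕ 0      ≡⟨ cong (_% n) (+-identityʳ (toℕ j)) ⟩
    toℕ j % n  ≡⟨ toℕ%n≡toℕ j ⟩
    toℕ j      ∎))
    where open ≡-Reasoning

  centredOffset-≤ : ∀ D a {j} → D + D < n → dist n a j ≤ D → centredOffset D a j ≤ D + D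
  centredOffset-≤ D a {j} 2D<n d≤D with dist≤⇒⊕ d≤D
  ... | e , e≤D , inj₁ j≡a⊕e = begin
    (diffMod n j a + D) % n ≤⟨ m%n≤m _ n ⟩
    diffMod n j a + D       ≡⟨ cong (_+ D) (diffMod-⊕ {a} {j} e j≡a⊕e) ⟩
    e % n + D               ≤⟨ +-monoˡ-≤ D (≤-trans (m%n≤m e n) e≤D) ⟩
    D + D                   ∎
    where open ≤-Reasoning
  ... | e , e≤D , inj₂ a≡j⊕e = begin
    (diffMod n j a + D) % n    ≡⟨ cong (λ w → (w + D) % n) (diffMod-⊕ {a} {j} (n ∸ e) (⊕-inverse {j} {a} e e≤n a≡j⊕e)) ⟩
    ((n ∸ e) % n + D) % n      ≡⟨ [a%n+b]%n≡[a+b]%n (n ∸ e) D ⟩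
    (n ∸ e + D) % n            ≡⟨ cong (_% n) wrap ⟩
    (D ∸ e + n) % n            ≡⟨ [m+n]%n≡m%n (D ∸ e) n ⟩
    (D ∸ e) % n                ≤⟨ m%n≤m (D ∸ e) n ⟩
    D ∸ e                      ≤⟨ m∸n≤m D e ⟩
    D                          ≤⟨ m≤m+n D D ⟩
    D + D                      ∎
    where
    open ≤-Reasoning
    e≤n : e ≤ n
    e≤n = ≤-trans e≤D (≤-trans (m≤m+n D D) (<⇒≤ 2D<n))
    wrap : n ∸ e + D ≡ D ∸ e + n
    wrap = trans (sym (+-∸-comm D e≤n)) (trans (cong (_∸ e) (+-comm n D)) (+-∸-comm n e≤D))

module _ {A : Set} where

  all-pairs-or-counterexample : {C Q : A → A → Set} → (∀ x y → Dec (C x y)) → (∀ x y → Dec (Q x y)) →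
    (L : List A) → ∃[ x ] ∃[ y ] (x ∈ L × y ∈ L × C x y × ¬ Q x y) ⊎ (∀ {x y} → x ∈ L → y ∈ L → C x y → Q x y)
  all-pairs-or-counterexample {C} {Q} C? Q? L with any? (λ x → any? (λ y → C? x y ×-dec ¬? (Q? x y)) L) L
  ... | yes some with x , x∈ , some-y ← find some with y , y∈ , c , ¬q ← find some-y =
    inj₁ (x , y , x∈ , y∈ , c , ¬q)
  ... | no none = inj₂ λ {x} {y} x∈ y∈ c → decidable-stable (Q? x y) λ ¬q →
    none (lose {P = λ x → Any (λ y → C x y × ¬ Q x y) L} x∈ (lose {P = λ y → C x y × ¬ Q x y} y∈ (c , ¬q)))

  length≤-cover : {P Q : A → Set} (P? : Decidable P) (Q? : Decidable Q) (L : List A) →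
                  (∀ {x} → x ∈ L → P x ⊎ Q x) → length L ≤ length (filter P? L) + length (filter Q? L)
  length≤-cover P? Q? [] _ = z≤n
  length≤-cover P? Q? (x ∷ L) cover with P? x | Q? x | length≤-cover P? Q? L (λ x∈ → cover (there x∈))
  ... | yes _ | yes _ | ih = s≤s (≤-trans ih (+-monoʳ-≤ _ (n≤1+n _)))
  ... | yes _ | no _  | ih = s≤s ih
  ... | no _  | yes _ | ih = ≤-trans (s≤s ih) (≤-reflexive (sym (+-suc _ _)))
  ... | no ¬p | no ¬q | _ with cover (here refl)
  ...   | inj₁ p = contradiction p ¬p
  ...   | inj₂ q = contradiction q ¬q

  length≤-fibres : (f : A → ℕ) (N M : ℕ) (L : List A) → Unique L → (∀ {x} → x ∈ L → f x < N) →
    (∀ F → Unique F → (∀ {x} → x ∈ F → x ∈ L) → (∀ {x y} → x ∈ F → y ∈ F → f x ≡ f y) → length F ≤ M) →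
    length L ≤ N * M
  length≤-fibres f zero M [] _ _ _ = z≤n
  length≤-fibres f zero M (x ∷ L) _ f< _ = contradiction (f< (here refl)) n≮0
  length≤-fibres f (suc N) M L !L f< fibre = begin
    length L                          ≤⟨ length≤-cover below? top? L (λ x∈ → m<1+n⇒m<n∨m≡n (f< x∈)) ⟩
    length lower + length upper       ≤⟨ +-mono-≤ lower≤N*M upper≤M ⟩
    N * M + M                         ≡⟨ +-comm (N * M) M ⟩
    M + N * M                         ∎
    where
    open ≤-Reasoning
    below? : Decidable (λ x → f x < N)
    below? x = f x <? N
    top? : Decidable (λ x → f x ≡ N)
    top? x = f x ≟ N
    lower = filter below? L
    upper = filter top? L
    ∈upper⁻ : ∀ {x} → x ∈ upper → x ∈ L × f x ≡ N
    ∈upper⁻ = ∈-filter⁻ top? {xs = L}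
    ∈lower⁻ : ∀ {x} → x ∈ lower → x ∈ L × f x < N
    ∈lower⁻ = ∈-filter⁻ below? {xs = L}
    upper≤M : length upper ≤ M
    upper≤M = fibre upper (filter⁺ top? !L) (λ x∈ → proj₁ (∈upper⁻ x∈))
      (λ x∈ y∈ → trans (proj₂ (∈upper⁻ x∈)) (sym (proj₂ (∈upper⁻ y∈))))
    lower≤N*M : length lower ≤ N * M
    lower≤N*M = length≤-fibres f N M lower (filter⁺ below? !L) (λ x∈ → proj₂ (∈lower⁻ x∈))
      (λ F !F F⊆ → fibre F !F (λ x∈ → proj₁ (∈lower⁻ (F⊆ x∈))))

  length≤-injection : (f : A → ℕ) (N : ℕ) (L : List A) → Unique L → (∀ {x} → x ∈ L → f x < N) →
                      (∀ {x y} → x ∈ L → y ∈ L → f x ≡ f y → x ≡ y) → length L ≤ N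
  length≤-injection f N L !L f< inj = subst (length L ≤_) (*-identityʳ N) (length≤-fibres f N 1 L !L f< singleton)
    where
    singleton : ∀ F → Unique F → (∀ {x} → x ∈ F → x ∈ L) → (∀ {x y} → x ∈ F → y ∈ F → f x ≡ f y) → length F ≤ 1
    singleton [] _ _ _ = z≤n
    singleton (_ ∷ []) _ _ _ = s≤s z≤n
    singleton (_ ∷ _ ∷ _) ((x≢y ∷ _) ∷ _) F⊆ same =
      contradiction (inj (F⊆ (here refl)) (F⊆ (there (here refl))) (same (here refl) (there (here refl)))) x≢y

-- Points within D of an anchor occupy a window of 2D + 1 consecutive positions; two positions of
-- the window with the same residue mod D + 1 are exactly D + 1 apart, which a cluster forbids.
cluster-length≤ : {A : Set} (m D : ℕ) .{{_ : NonZero m}} → suc D + suc D ≤ m → (q : A → Fin m) →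
  (F : List A) → Unique F → (∀ {x y} → x ∈ F → y ∈ F → q x ≡ q y → x ≡ y) →
  (∀ {x y} → x ∈ F → y ∈ F → dist m (q x) (q y) ≤ D) → length F ≤ suc D
cluster-length≤ m D 2D<m q [] _ _ _ = z≤n
cluster-length≤ {A} m D 2D<m q F@(a ∷ _) !F q-inj close =
  length≤-injection residue (suc D) F !F (λ {x} _ → m%n<n (position x) (suc D)) residue-injective
  where
  open Cyclic m
  position : A → ℕ
  position x = centredOffset D (q a) (q x)
  residue : A → ℕ
  residue x = position x % suc D
  position< : ∀ {x} → x ∈ F → position x < suc D + suc D
  position< x∈ = s≤s (≤-trans (centredOffset-≤ D (q a) D+D<m (close (here refl) x∈)) (+-monoʳ-≤ D (n≤1+n D)))
    where
    D+D<m : D + D < m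
    D+D<m = ≤-trans (s≤s (+-monoʳ-≤ D (n≤1+n D))) 2D<m
  apart : ∀ {x y} → x ∈ F → y ∈ F → position y ≡ position x + suc D → x ≡ y
  apart x∈ y∈ eq = contradiction (close x∈ y∈)
    (<⇒≱ (⊕⇒dist≥ D 2D<m (centredOffset-+ D (q a) (suc D) (sym eq))))
  residue-injective : ∀ {x y} → x ∈ F → y ∈ F → residue x ≡ residue y → x ≡ y
  residue-injective x∈ y∈ eq with %-window-injective (suc D) (position< x∈) (position< y∈) eq
  ... | inj₁ same = q-inj x∈ y∈ (centredOffset-injective D (q a) same)
  ... | inj₂ (inj₁ y-above) = apart x∈ y∈ y-above
  ... | inj₂ (inj₂ x-above) = sym (apart y∈ x∈ x-above)

band-length≤ : {A : Set} {n m : ℕ} .{{_ : NonZero n}} .{{_ : NonZero m}} (p : A → Fin n) (q : A → Fin m) →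
  (∀ {x y} → p x ≡ p y → q x ≡ q y → x ≡ y) → (K D : ℕ) → K + K < n → suc D + suc D ≤ m →
  (i₀ : Fin n) (L : List A) → Unique L → (∀ {x} → x ∈ L → dist n i₀ (p x) ≤ K) →
  (∀ {x y} → x ∈ L → y ∈ L → p x ≡ p y → dist m (q x) (q y) ≤ D) →
  length L ≤ suc (K + K) * suc D
band-length≤ {A} {n} {m} p q pq-inj K D 2K<n 2D<m i₀ L !L near spread =
  length≤-fibres position (suc (K + K)) (suc D) L !L (λ x∈ → s≤s (centredOffset-≤ K i₀ 2K<n (near x∈))) line
  where
  open Cyclic n
  position : A → ℕ
  position x = centredOffset K i₀ (p x)
  line : ∀ F → Unique F → (∀ {x} → x ∈ F → x ∈ L) → (∀ {x y} → x ∈ F → y ∈ F → position x ≡ position y) →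
         length F ≤ suc D
  line F !F F⊆L same = cluster-length≤ m D 2D<m q F !F
    (λ x∈ y∈ → pq-inj (same-p x∈ y∈)) (λ x∈ y∈ → spread (F⊆L x∈) (F⊆L y∈) (same-p x∈ y∈))
    where
    same-p : ∀ {x y} → x ∈ F → y ∈ F → p x ≡ p y
    same-p x∈ y∈ = centredOffset-injective K i₀ (same x∈ y∈)

module _ {n₁ n₂ : ℕ} .{{_ : NonZero n₁}} .{{_ : NonZero n₂}} where

  RowSpread≤ : ℕ → List (Rect n₁ n₂) → Set
  RowSpread≤ D ℛ = ∀ {R S} → R ∈ ℛ → S ∈ ℛ → proj₂ R ≡ proj₂ S → dist n₁ (proj₁ R) (proj₁ S) ≤ D

  ColumnSpread≤ : ℕ → List (Rect n₁ n₂) → Set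
  ColumnSpread≤ D ℛ = ∀ {R S} → R ∈ ℛ → S ∈ ℛ → proj₁ R ≡ proj₁ S → dist n₂ (proj₂ R) (proj₂ S) ≤ D

  proj-intersecting-length≤ : (K₁ K₂ D₁ D₂ : ℕ) → K₁ + K₁ < n₁ → K₂ + K₂ < n₂ →
    suc D₁ + suc D₁ ≤ n₁ → suc D₂ + suc D₂ ≤ n₂ →
    (ℛ : List (Rect n₁ n₂)) → Unique ℛ → ProjIntersecting n₁ n₂ (suc K₁) (suc K₂) ℛ →
    RowSpread≤ D₁ ℛ → ColumnSpread≤ D₂ ℛ →
    length ℛ ≤ suc (K₁ + K₁) * suc D₂ + suc (K₂ + K₂) * suc D₁
  proj-intersecting-length≤ K₁ K₂ D₁ D₂ 2K₁<n₁ 2K₂<n₂ 2D₁<n₁ 2D₂<n₂ [] _ _ _ _ = z≤n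
  proj-intersecting-length≤ K₁ K₂ D₁ D₂ 2K₁<n₁ 2K₂<n₂ 2D₁<n₁ 2D₂<n₂ ℛ@(R₀ ∷ _) !ℛ meets rows columns = begin
    length ℛ                                            ≤⟨ length≤-cover near₁? near₂? ℛ meets-R₀ ⟩
    length (filter near₁? ℛ) + length (filter near₂? ℛ) ≤⟨ +-mono-≤ columns-near-R₀ rows-near-R₀ ⟩
    suc (K₁ + K₁) * suc D₂ + suc (K₂ + K₂) * suc D₁     ∎
    where
    open ≤-Reasoning
    near₁? : Decidable (λ (R : Rect n₁ n₂) → dist n₁ (proj₁ R₀) (proj₁ R) ≤ K₁)
    near₁? R = dist n₁ (proj₁ R₀) (proj₁ R) ≤? K₁
    near₂? : Decidable (λ (R : Rect n₁ n₂) → dist n₂ (proj₂ R₀) (proj₂ R) ≤ K₂)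
    near₂? R = dist n₂ (proj₂ R₀) (proj₂ R) ≤? K₂
    meets-R₀ : ∀ {R} → R ∈ ℛ → dist n₁ (proj₁ R₀) (proj₁ R) ≤ K₁ ⊎ dist n₂ (proj₂ R₀) (proj₂ R) ≤ K₂
    meets-R₀ {R} R∈ with meets R₀ R (here refl) R∈
    ... | inj₁ I-meet = inj₁ (Cyclic.meet⇒dist≤ n₁ K₁ I-meet)
    ... | inj₂ J-meet = inj₂ (Cyclic.meet⇒dist≤ n₂ K₂ J-meet)
    ∈near₁⁻ : ∀ {R} → R ∈ filter near₁? ℛ → R ∈ ℛ × dist n₁ (proj₁ R₀) (proj₁ R) ≤ K₁
    ∈near₁⁻ = ∈-filter⁻ near₁? {xs = ℛ}
    ∈near₂⁻ : ∀ {R} → R ∈ filter near₂? ℛ → R ∈ ℛ × dist n₂ (proj₂ R₀) (proj₂ R) ≤ K₂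
    ∈near₂⁻ = ∈-filter⁻ near₂? {xs = ℛ}
    columns-near-R₀ : length (filter near₁? ℛ) ≤ suc (K₁ + K₁) * suc D₂
    columns-near-R₀ = band-length≤ proj₁ proj₂ (λ e₁ e₂ → ×-≡,≡→≡ (e₁ , e₂)) K₁ D₂ 2K₁<n₁ 2D₂<n₂
      (proj₁ R₀) (filter near₁? ℛ) (filter⁺ near₁? !ℛ) (λ R∈ → proj₂ (∈near₁⁻ R∈))
      (λ R∈ S∈ → columns (proj₁ (∈near₁⁻ R∈)) (proj₁ (∈near₁⁻ S∈)))
    rows-near-R₀ : length (filter near₂? ℛ) ≤ suc (K₂ + K₂) * suc D₁
    rows-near-R₀ = band-length≤ proj₂ proj₁ (λ e₂ e₁ → ×-≡,≡→≡ (e₁ , e₂)) K₂ D₁ 2K₂<n₂ 2D₁<n₁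
      (proj₂ R₀) (filter near₂? ℛ) (filter⁺ near₂? !ℛ) (λ R∈ → proj₂ (∈near₂⁻ R∈))
      (λ R∈ S∈ → rows (proj₁ (∈near₂⁻ R∈)) (proj₁ (∈near₂⁻ S∈)))

two-bands<9b² : ∀ {k ℓ b} → k ≤ b → ℓ ≤ b →
  suc (k + k) * suc (ℓ + suc b) + suc (ℓ + ℓ) * suc (k + suc b) < 9 * (suc b * suc b)
two-bands<9b² {k} {ℓ} {b} k≤b ℓ≤b = begin-strict
  suc (k + k) * suc (ℓ + suc b) + suc (ℓ + ℓ) * suc (k + suc b) ≤⟨ +-mono-≤ (band≤ k≤b ℓ≤b) (band≤ ℓ≤b k≤b) ⟩
  widest + widest                                               <⟨ n<1+n (widest + widest) ⟩
  suc (widest + widest)                                         ≤⟨ m≤m+n (suc (widest + widest)) (b * b + 6 * b + 4) ⟩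
  suc (widest + widest) + (b * b + 6 * b + 4)                   ≡⟨ expand b ⟨
  9 * (suc b * suc b)                                           ∎
  where
  open ≤-Reasoning
  widest : ℕ
  widest = suc (b + b) * suc (b + suc b)
  band≤ : ∀ {x y} → x ≤ b → y ≤ b → suc (x + x) * suc (y + suc b) ≤ widest
  band≤ x≤b y≤b = *-mono-≤ (s≤s (+-mono-≤ x≤b x≤b)) (s≤s (+-monoˡ-≤ (suc b) y≤b))
  expand : ∀ x → 9 * (suc x * suc x) ≡
           suc (suc (x + x) * suc (x + suc x) + suc (x + x) * suc (x + suc x)) + (x * x + 6 * x + 4)
  expand = solve-∀

double-bounds : ∀ {k b n} → 2 * (suc k + suc b) ≤ n → k + k < n × suc (k + suc b) + suc (k + suc b) ≤ n
double-bounds {k} {b} {n} 2[k+b]≤n = ≤-trans (s≤s (+-mono-≤ k≤ (≤-trans k≤ (n≤1+n _)))) 2D≤n , 2D≤n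
  where
  2D≤n : suc (k + suc b) + suc (k + suc b) ≤ n
  2D≤n = subst (_≤ n) (cong (suc k + suc b +_) (+-identityʳ (suc k + suc b))) 2[k+b]≤n
  k≤ : k ≤ k + suc b
  k≤ = m≤m+n k (suc b)

lemma3 : (k ℓ b n₁ n₂ : ℕ) .{{_ : NonZero k}} .{{_ : NonZero ℓ}} .{{_ : NonZero b}}
         .{{_ : NonZero n₁}} .{{_ : NonZero n₂}} →
         k ≤ b → ℓ ≤ b → 2 * (k + b) ≤ n₁ → 2 * (ℓ + b) ≤ n₂ →
         (ℛ : List (Rect n₁ n₂)) → Unique ℛ →
         ProjIntersecting n₁ n₂ k ℓ ℛ →
         length ℛ ≥ 9 * (b * b) →
         (∃[ R₁ ] ∃[ R₂ ] (R₁ ∈ ℛ × R₂ ∈ ℛ × proj₂ R₁ ≡ proj₂ R₂ ×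
            IntervalDist≥ n₁ k (proj₁ R₁) (proj₁ R₂) (suc b)))
         ⊎
         (∃[ R₃ ] ∃[ R₄ ] (R₃ ∈ ℛ × R₄ ∈ ℛ × proj₁ R₃ ≡ proj₁ R₄ ×
            IntervalDist≥ n₂ ℓ (proj₂ R₃) (proj₂ R₄) (suc b)))
lemma3 (suc k) (suc ℓ) (suc b) n₁ n₂ k<b ℓ<b 2[k+b]≤n₁ 2[ℓ+b]≤n₂ ℛ !ℛ meets ℛ≥9b²
  with all-pairs-or-counterexample (λ R S → proj₂ R Fin.≟ proj₂ S)
                                   (λ R S → dist n₁ (proj₁ R) (proj₁ S) ≤? k + suc b) ℛ
     | all-pairs-or-counterexample (λ R S → proj₁ R Fin.≟ proj₁ S)
                                   (λ R S → dist n₂ (proj₂ R) (proj₂ S) ≤? ℓ + suc b) ℛ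
... | inj₁ (R₁ , R₂ , R₁∈ , R₂∈ , same-row , far) | _ =
  inj₁ (R₁ , R₂ , R₁∈ , R₂∈ , same-row , Cyclic.far-starts⇒far-intervals n₁ k (suc b) far)
... | inj₂ _ | inj₁ (R₃ , R₄ , R₃∈ , R₄∈ , same-column , far) =
  inj₂ (R₃ , R₄ , R₃∈ , R₄∈ , same-column , Cyclic.far-starts⇒far-intervals n₂ ℓ (suc b) far)
... | inj₂ rows | inj₂ columns = contradiction
  (proj-intersecting-length≤ k ℓ (k + suc b) (ℓ + suc b) 2k<n₁ 2ℓ<n₂ 2D₁≤n₁ 2D₂≤n₂ ℛ !ℛ meets rows columns)
  (<⇒≱ (<-≤-trans (two-bands<9b² (≤-pred k<b) (≤-pred ℓ<b)) ℛ≥9b²))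
  where
  2k<n₁ = proj₁ (double-bounds 2[k+b]≤n₁)
  2D₁≤n₁ = proj₂ (double-bounds 2[k+b]≤n₁)
  2ℓ<n₂ = proj₁ (double-bounds 2[ℓ+b]≤n₂)
  2D₂≤n₂ = proj₂ (double-bounds 2[ℓ+b]≤n₂)
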